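{- For every positive integer $n$ we have $C(2n)=C_0(n)^2$, and for every integer $n\ge 2$, \[ 2C_0(n-1)^2\le C(2n+1)\le C_1(n)^2 . \]
   Context: Let $[n]=\{1,2,\dots,n\}$ and $[n]_{\rm o}=\{1,3,\dots,2n-1\}$ (the first $n$ odd positive integers). Let $C(n)$ be the number of permutations $\sigma$ of $[n]$ with $\gcd(j,\sigma(j))=1$ for all $j\in[n]$. Let $C_0(n)$ be the number of one-to-one functions $f:[n]_{\rm o}\to[n]$ with $\gcd(i,f(i))=1$ for every $i\in[n]_{\rm o}$, and let $C_1(n)$ be the number of one-to-one functions $f:[n]\to[n+1]_{\rm o}$ with $\gcd(i,f(i))=1$ for every $i\in[n]$. -}

module Defs where

open import Data.Nat using (ℕ; zero; suc; _+_; _*_; _≟_)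
open import Data.Nat.GCD using (gcd)
open import Data.List using (List; []; _∷_; map; upTo)
open import Data.Product using (_×_; _,_; proj₁; proj₂)
open import Relation.Nullary using (yes; no)

range : ℕ → List ℕ
range n = map suc (upTo n)

oddRange : ℕ → List ℕ
oddRange n = map (λ k → suc (k + k)) (upTo n)

picks : List ℕ → List (ℕ × List ℕ)
picks [] = []
picks (x ∷ xs) = (x , xs) ∷ map (λ p → proj₁ p , x ∷ proj₂ p) (picks xs)

-- coprimeInj dom cod = number of one-to-one functions f from the (duplicate-free)
-- list dom to the (duplicate-free) list cod with gcd(i, f(i)) = 1 for all i in dom.
mutual
  coprimeInj : List ℕ → List ℕ → ℕ
  coprimeInj [] cod = 1
  coprimeInj (i ∷ dom) cod = sumChoices i dom (picks cod)

  sumChoices : ℕ → List ℕ → List (ℕ × List ℕ) → ℕ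
  sumChoices i dom [] = 0
  sumChoices i dom ((y , rest) ∷ ps) with gcd i y ≟ 1
  ... | yes _ = coprimeInj dom rest + sumChoices i dom ps
  ... | no _ = sumChoices i dom ps

C : ℕ → ℕ
C n = coprimeInj (range n) (range n)

C₀ : ℕ → ℕ
C₀ n = coprimeInj (oddRange n) (range n)

C₁ : ℕ → ℕ
C₁ n = coprimeInj (range n) (oddRange (suc n))

{-# OPTIONS --safe #-}

-- All the counts are permanents of the 0/1 matrix of coprimality, restricted to suitable rows
-- and columns. Two even numbers are never coprime, so a coprime permutation of [2n] maps the n
-- evens into the n odds and therefore the odds onto the evens: the permanent splits into two
-- blocks, each equal to C₀(n) because gcd(i, 2j) = 1 ⇔ gcd(i, j) = 1 for odd i.
-- On [2n+1] the n evens go injectively into the n+1 odds, missing exactly one odd u, and the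
-- odds go bijectively onto the evens together with u. The inverse of that bijection is fixed by
-- its restriction to the evens, an injection into the odds, so there are at most C₁(n) of them;
-- and summing over u the injections of the evens that miss u counts each injection once, giving
-- C₁(n) again.
-- For the lower bound, 2n+1, 2n and 2n−1 are pairwise coprime, and each of their two
-- derangements extends every coprime permutation of [2n−2].
module Submission where

open import Defs
open import Algebra.Properties.CommutativeSemigroup as CommSemigroupProperties using ()
open import Data.Bool.Base using (true; false; if_then_else_)
open import Data.List using (List; []; _∷_; [_]; _++_; map; length; upTo; downFrom)
open import Data.List.Properties using (length-map; length-upTo; ++-identityʳ; reverse-upTo)
open import Data.List.Relation.Unary.All as All using (All; []; _∷_)
import Data.List.Relation.Unary.All.Properties as Allₚ
open import Data.List.Relation.Binary.Permutation.Propositional as ↭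
  using (_↭_; ↭-sym; ↭-trans; ↭-reflexive)
import Data.List.Relation.Binary.Permutation.Propositional.Properties as ↭ₚ
open import Data.Nat using (ℕ; zero; suc; _+_; _*_; _∸_; _≤_; _<_; z≤n; s≤s; _≟_)
open import Data.Nat.Properties
open import Data.Nat.Coprimality as Coprime
  using (Coprime; coprime?; coprime-+; coprime-factors; 1-coprimeTo; gcd≡1⇒coprime; coprime⇒gcd≡1)
open import Data.Nat.Divisibility using (_∣_; ∣-refl; ∣-trans; m∣m*n; n∣m*n)
open import Data.Nat.GCD using (gcd)
open import Data.Product using (_×_; _,_)
open import Function using (_∘_; flip; _⇔_; mk⇔)
open import Relation.Binary.PropositionalEquality hiding ([_])
open import Relation.Nullary using (¬_; does; yes; no)
open import Relation.Nullary.Decidable using (does-⇔; dec-true; dec-false)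

open CommSemigroupProperties +-commutativeSemigroup using ()
  renaming (interchange to +-interchange; x∙yz≈y∙xz to +-leftComm)
open CommSemigroupProperties *-commutativeSemigroup using ()
  renaming (x∙yz≈y∙xz to *-leftComm)
open ≡-Reasoning

∑ : {A : Set} → List A → (A → ℕ) → ℕ
∑ []       f = 0
∑ (x ∷ xs) f = f x + ∑ xs f

module _ {A : Set} where

  ∑-congᴬ : {f g : A → ℕ} {xs : List A} → All (λ x → f x ≡ g x) xs → ∑ xs f ≡ ∑ xs g
  ∑-congᴬ []       = refl
  ∑-congᴬ (e ∷ es) = cong₂ _+_ e (∑-congᴬ es)

  ∑-cong : {f g : A → ℕ} → (∀ x → f x ≡ g x) → ∀ xs → ∑ xs f ≡ ∑ xs g
  ∑-cong e xs = ∑-congᴬ (All.universal e xs)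

  ∑-monoᴬ : {f g : A → ℕ} {xs : List A} → All (λ x → f x ≤ g x) xs → ∑ xs f ≤ ∑ xs g
  ∑-monoᴬ []       = z≤n
  ∑-monoᴬ (e ∷ es) = +-mono-≤ e (∑-monoᴬ es)

  ∑-mono : {f g : A → ℕ} → (∀ x → f x ≤ g x) → ∀ xs → ∑ xs f ≤ ∑ xs g
  ∑-mono e xs = ∑-monoᴬ (All.universal e xs)

  ∑-zero : (xs : List A) → ∑ xs (λ _ → 0) ≡ 0
  ∑-zero []       = refl
  ∑-zero (_ ∷ xs) = ∑-zero xs

  ∑-map : {B : Set} (g : B → A) (f : A → ℕ) (xs : List B) → ∑ (map g xs) f ≡ ∑ xs (f ∘ g)
  ∑-map g f []       = refl
  ∑-map g f (x ∷ xs) = cong (f (g x) +_) (∑-map g f xs)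

  ∑-distrib-+ : ∀ (f g : A → ℕ) xs → ∑ xs (λ x → f x + g x) ≡ ∑ xs f + ∑ xs g
  ∑-distrib-+ f g []       = refl
  ∑-distrib-+ f g (x ∷ xs) =
    trans (cong (f x + g x +_) (∑-distrib-+ f g xs)) (+-interchange (f x) (g x) _ _)

  *-distribˡ-∑ : ∀ c (f : A → ℕ) xs → c * ∑ xs f ≡ ∑ xs (λ x → c * f x)
  *-distribˡ-∑ c f []       = *-zeroʳ c
  *-distribˡ-∑ c f (x ∷ xs) =
    trans (*-distribˡ-+ c (f x) _) (cong (c * f x +_) (*-distribˡ-∑ c f xs))

  *-distribʳ-∑ : ∀ c (f : A → ℕ) xs → ∑ xs f * c ≡ ∑ xs (λ x → f x * c)
  *-distribʳ-∑ c f xs =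
    trans (*-comm _ c) (trans (*-distribˡ-∑ c f xs) (∑-cong (λ x → *-comm c (f x)) xs))

module _ {A B : Set} where

  ∑-comm : (xs : List A) (ys : List B) (f : A → B → ℕ) →
           ∑ xs (λ x → ∑ ys (f x)) ≡ ∑ ys (λ y → ∑ xs (λ x → f x y))
  ∑-comm []       ys f = sym (∑-zero ys)
  ∑-comm (x ∷ xs) ys f =
    trans (cong (∑ ys (f x) +_) (∑-comm xs ys f)) (sym (∑-distrib-+ (f x) _ ys))

  ∑-*-exchange : (xs : List A) (ys : List B) (f : A → ℕ) (g : B → ℕ) (h : A → B → ℕ) →
                 ∑ xs (λ x → f x * ∑ ys (λ y → g y * h x y))
                 ≡ ∑ ys (λ y → g y * ∑ xs (λ x → f x * h x y))
  ∑-*-exchange xs ys f g h = begin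
    ∑ xs (λ x → f x * ∑ ys (λ y → g y * h x y))
      ≡⟨ ∑-cong (λ x → *-distribˡ-∑ (f x) _ ys) xs ⟩
    ∑ xs (λ x → ∑ ys (λ y → f x * (g y * h x y)))
      ≡⟨ ∑-comm xs ys _ ⟩
    ∑ ys (λ y → ∑ xs (λ x → f x * (g y * h x y)))
      ≡⟨ ∑-cong (λ y → ∑-cong (λ x → *-leftComm (f x) (g y) _) xs) ys ⟩
    ∑ ys (λ y → ∑ xs (λ x → g y * (f x * h x y)))
      ≡⟨ ∑-cong (λ y → sym (*-distribˡ-∑ (g y) _ xs)) ys ⟩
    ∑ ys (λ y → g y * ∑ xs (λ x → f x * h x y)) ∎

Pick : Set
Pick = ℕ × List ℕ

picks-length : (J : List ℕ) → All (λ (_ , J′) → suc (length J′) ≡ length J) (picks J)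
picks-length []      = []
picks-length (j ∷ J) = refl ∷ Allₚ.map⁺ (All.map (cong suc) (picks-length J))

picks-All : {P : ℕ → Set} {J : List ℕ} → All P J → All (λ (j , J′) → P j × All P J′) (picks J)
picks-All []       = []
picks-All (p ∷ ps) = (p , ps) ∷ Allₚ.map⁺ (All.map (λ (pj , pJ′) → pj , p ∷ pJ′) (picks-All ps))

∑-picks-cong : (J : List ℕ) {f g : Pick → ℕ} →
               (∀ {j J′} → suc (length J′) ≡ length J → f (j , J′) ≡ g (j , J′)) →
               ∑ (picks J) f ≡ ∑ (picks J) g
∑-picks-cong J e = ∑-congᴬ (All.map e (picks-length J))

∑-picks-mono : (J : List ℕ) {f g : Pick → ℕ} →
               (∀ {j J′} → suc (length J′) ≡ length J → f (j , J′) ≤ g (j , J′)) →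
               ∑ (picks J) f ≤ ∑ (picks J) g
∑-picks-mono J e = ∑-monoᴬ (All.map e (picks-length J))

∑-picks-∷ : ∀ j J (f : Pick → ℕ) →
            ∑ (picks (j ∷ J)) f ≡ f (j , J) + ∑ (picks J) (λ (k , J′) → f (k , j ∷ J′))
∑-picks-∷ j J f = cong (f (j , J) +_) (∑-map _ f (picks J))

∑-picks-++ : ∀ X Y (f : Pick → ℕ) →
             ∑ (picks (X ++ Y)) f ≡ ∑ (picks X) (λ (x , X′) → f (x , X′ ++ Y))
                                  + ∑ (picks Y) (λ (y , Y′) → f (y , X ++ Y′))
∑-picks-++ []      Y f = refl
∑-picks-++ (x ∷ X) Y f = begin
  ∑ (picks (x ∷ X ++ Y)) f
    ≡⟨ ∑-picks-∷ x (X ++ Y) f ⟩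
  f (x , X ++ Y) + ∑ (picks (X ++ Y)) (λ (k , Z) → f (k , x ∷ Z))
    ≡⟨ cong (f (x , X ++ Y) +_) (∑-picks-++ X Y _) ⟩
  f (x , X ++ Y) + (L + R)
    ≡⟨ +-assoc (f (x , X ++ Y)) L R ⟨
  f (x , X ++ Y) + L + R
    ≡⟨ cong (_+ R) (∑-picks-∷ x X _) ⟨
  ∑ (picks (x ∷ X)) (λ (k , X′) → f (k , X′ ++ Y)) + R ∎
  where
    L = ∑ (picks X) (λ (k , X′) → f (k , x ∷ X′ ++ Y))
    R = ∑ (picks Y) (λ (k , Y′) → f (k , x ∷ X ++ Y′))

∑-picks-map : ∀ (g : ℕ → ℕ) J (f : Pick → ℕ) →
              ∑ (picks (map g J)) f ≡ ∑ (picks J) (λ (j , J′) → f (g j , map g J′))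
∑-picks-map g []      f = refl
∑-picks-map g (j ∷ J) f = begin
  ∑ (picks (g j ∷ map g J)) f
    ≡⟨ ∑-picks-∷ (g j) (map g J) f ⟩
  f (g j , map g J) + ∑ (picks (map g J)) (λ (k , J′) → f (k , g j ∷ J′))
    ≡⟨ cong (f (g j , map g J) +_) (∑-picks-map g J _) ⟩
  f (g j , map g J) + ∑ (picks J) (λ (k , J′) → f (g k , g j ∷ map g J′))
    ≡⟨ ∑-picks-∷ j J _ ⟨
  ∑ (picks (j ∷ J)) (λ (k , J′) → f (g k , map g J′)) ∎

∑-picks-1 : (J : List ℕ) → ∑ (picks J) (λ _ → 1) ≡ length J
∑-picks-1 []      = refl
∑-picks-1 (j ∷ J) = trans (∑-picks-∷ j J (λ _ → 1)) (cong suc (∑-picks-1 J))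

∑-pairs : (ℕ → ℕ → List ℕ → ℕ) → List ℕ → ℕ
∑-pairs F J = ∑ (picks J) λ (j , J′) → ∑ (picks J′) λ (k , J″) → F j k J″

∑-pairs-cong : {F G : ℕ → ℕ → List ℕ → ℕ} → (∀ j k J″ → F j k J″ ≡ G j k J″) →
               ∀ J → ∑-pairs F J ≡ ∑-pairs G J
∑-pairs-cong e J = ∑-cong (λ (j , J′) → ∑-cong (λ (k , J″) → e j k J″) (picks J′)) (picks J)

∑-pairs-∷ : ∀ F j J → ∑-pairs F (j ∷ J) ≡ ∑ (picks J) (λ (k , J′) → F j k J′)
                                        + (∑ (picks J) (λ (k , J′) → F k j J′)
                                           + ∑-pairs (λ k l J″ → F k l (j ∷ J″)) J)
∑-pairs-∷ F j J = begin
  ∑ (picks (j ∷ J)) G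
    ≡⟨ ∑-picks-∷ j J G ⟩
  Firstⱼ + ∑ (picks J) (λ (k , J′) → ∑ (picks (j ∷ J′)) (λ (l , J″) → F k l J″))
    ≡⟨ cong (Firstⱼ +_)
            (∑-cong (λ (k , J′) → ∑-picks-∷ j J′ (λ (l , J″) → F k l J″)) (picks J)) ⟩
  Firstⱼ + ∑ (picks J) (λ (k , J′) → F k j J′ + ∑ (picks J′) (λ (l , J″) → F k l (j ∷ J″)))
    ≡⟨ cong (Firstⱼ +_) (∑-distrib-+ _ _ (picks J)) ⟩
  Firstⱼ + (∑ (picks J) (λ (k , J′) → F k j J′) + ∑-pairs (λ k l J″ → F k l (j ∷ J″)) J) ∎
  where
    G : Pick → ℕ
    G (k , J′) = ∑ (picks J′) (λ (l , J″) → F k l J″)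
    Firstⱼ = ∑ (picks J) (λ (k , J′) → F j k J′)

∑-pairs-swap : ∀ F J → ∑-pairs F J ≡ ∑-pairs (λ j k → F k j) J
∑-pairs-swap F []      = refl
∑-pairs-swap F (j ∷ J) = begin
  ∑-pairs F (j ∷ J)
    ≡⟨ ∑-pairs-∷ F j J ⟩
  L + (R + ∑-pairs (λ k l J″ → F k l (j ∷ J″)) J)
    ≡⟨ cong (λ s → L + (R + s)) (∑-pairs-swap _ J) ⟩
  L + (R + ∑-pairs (λ k l J″ → F l k (j ∷ J″)) J)
    ≡⟨ +-leftComm L R _ ⟩
  R + (L + ∑-pairs (λ k l J″ → F l k (j ∷ J″)) J)
    ≡⟨ ∑-pairs-∷ (λ k l → F l k) j J ⟨
  ∑-pairs (λ k l → F l k) (j ∷ J) ∎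
  where
    L = ∑ (picks J) (λ (k , J′) → F j k J′)
    R = ∑ (picks J) (λ (k , J′) → F k j J′)

-- permanent w I J sums, over the injections f from I into J, the product of the w i (f i);
-- for a 0/1-valued w it counts the injections along which w is 1.
permanent : (ℕ → ℕ → ℕ) → List ℕ → List ℕ → ℕ
permanent w []      J = 1
permanent w (i ∷ I) J = ∑ (picks J) λ (j , J′) → w i j * permanent w I J′

permanent-cong : ∀ {w w′} I {J} → All (λ j → All (λ i → w i j ≡ w′ i j) I) J →
                 permanent w I J ≡ permanent w′ I J
permanent-cong []      _  = refl
permanent-cong (i ∷ I) es =
  ∑-congᴬ (All.map (λ (eⱼ , es′) → cong₂ _*_ (All.head eⱼ) (permanent-cong I (All.map All.tail es′)))
                   (picks-All es))

permanent-map-rows : ∀ w (g : ℕ → ℕ) I J → permanent w (map g I) J ≡ permanent (w ∘ g) I J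
permanent-map-rows w g []      J = refl
permanent-map-rows w g (i ∷ I) J =
  ∑-cong (λ (j , J′) → cong (w (g i) j *_) (permanent-map-rows w g I J′)) (picks J)

permanent-map-columns : ∀ w (g : ℕ → ℕ) I J →
                        permanent w I (map g J) ≡ permanent (λ i j → w i (g j)) I J
permanent-map-columns w g []      J = refl
permanent-map-columns w g (i ∷ I) J = trans (∑-picks-map g J _)
  (∑-cong (λ (j , J′) → cong (w i (g j) *_) (permanent-map-columns w g I J′)) (picks J))

permanent-∷-cong : ∀ w i {I I′} → (∀ J → permanent w I J ≡ permanent w I′ J) →
                   ∀ J → permanent w (i ∷ I) J ≡ permanent w (i ∷ I′) J
permanent-∷-cong w i e J = ∑-cong (λ (j , J′) → cong (w i j *_) (e J′)) (picks J)

permanent-∷∷ : ∀ w a b I J →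
               permanent w (a ∷ b ∷ I) J ≡ ∑-pairs (λ j k J″ → w a j * (w b k * permanent w I J″)) J
permanent-∷∷ w a b I J = ∑-cong (λ (j , J′) → *-distribˡ-∑ (w a j) _ (picks J′)) (picks J)

permanent-swap : ∀ w a b I J → permanent w (a ∷ b ∷ I) J ≡ permanent w (b ∷ a ∷ I) J
permanent-swap w a b I J = begin
  permanent w (a ∷ b ∷ I) J
    ≡⟨ permanent-∷∷ w a b I J ⟩
  ∑-pairs (λ j k J″ → w a j * (w b k * permanent w I J″)) J
    ≡⟨ ∑-pairs-swap _ J ⟩
  ∑-pairs (λ j k J″ → w a k * (w b j * permanent w I J″)) J
    ≡⟨ ∑-pairs-cong (λ j k J″ → *-leftComm (w a k) (w b j) _) J ⟩
  ∑-pairs (λ j k J″ → w b j * (w a k * permanent w I J″)) J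
    ≡⟨ permanent-∷∷ w b a I J ⟨
  permanent w (b ∷ a ∷ I) J ∎

permanent-↭-rows : ∀ w {I I′} → I ↭ I′ → ∀ J → permanent w I J ≡ permanent w I′ J
permanent-↭-rows w ↭.refl                  J = refl
permanent-↭-rows w (↭.prep {I} {I′} i p)   J = permanent-∷-cong w i {I} {I′} (permanent-↭-rows w p) J
permanent-↭-rows w (↭.swap {I} {I′} a b p) J = trans (permanent-swap w a b I J)
  (permanent-∷-cong w b {a ∷ I} {a ∷ I′} (permanent-∷-cong w a {I} {I′} (permanent-↭-rows w p)) J)
permanent-↭-rows w (↭.trans p q)           J = trans (permanent-↭-rows w p J) (permanent-↭-rows w q J)

length<⇒permanent≡0 : ∀ w I J → length J < length I → permanent w I J ≡ 0
length<⇒permanent≡0 w (i ∷ I) J (s≤s |J|≤|I|) = trans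
  (∑-picks-cong J (λ {j} {J′} eq → trans
    (cong (w i j *_) (length<⇒permanent≡0 w I J′ (≤-trans (≤-reflexive eq) |J|≤|I|)))
    (*-zeroʳ (w i j))))
  (∑-zero (picks J))

-- Expansion along the column j: an injection into j ∷ J either misses j or hits it from some row.
permanent-column : ∀ w I j J →
  permanent w I (j ∷ J) ≡ permanent w I J + ∑ (picks I) (λ (i , I′) → w i j * permanent w I′ J)
permanent-column w []      j J = refl
permanent-column w (i ∷ I) j J = begin
  permanent w (i ∷ I) (j ∷ J)
    ≡⟨ ∑-picks-∷ j J _ ⟩
  w i j * permanent w I J + ∑ (picks J) (λ (k , J′) → w i k * permanent w I (j ∷ J′))
    ≡⟨ cong (w i j * permanent w I J +_) (trans
         (∑-cong (λ (k , J′) → trans (cong (w i k *_) (permanent-column w I j J′))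
                                     (*-distribˡ-+ (w i k) _ _)) (picks J))
         (∑-distrib-+ _ _ (picks J))) ⟩
  w i j * permanent w I J + (permanent w (i ∷ I) J + Rest)
    ≡⟨ +-leftComm (w i j * permanent w I J) _ Rest ⟩
  permanent w (i ∷ I) J + (w i j * permanent w I J + Rest)
    ≡⟨ cong (λ s → permanent w (i ∷ I) J + (w i j * permanent w I J + s))
            (∑-*-exchange (picks J) (picks I) (λ (k , _) → w i k) (λ (l , _) → w l j)
                          (λ (_ , J′) (_ , I′) → permanent w I′ J′)) ⟩
  permanent w (i ∷ I) J + (w i j * permanent w I J
                           + ∑ (picks I) (λ (l , I′) → w l j * permanent w (i ∷ I′) J))
    ≡⟨ cong (permanent w (i ∷ I) J +_) (∑-picks-∷ i I _) ⟨
  permanent w (i ∷ I) J + ∑ (picks (i ∷ I)) (λ (l , I′) → w l j * permanent w I′ J) ∎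
  where
    Rest = ∑ (picks J) (λ (k , J′) → w i k * ∑ (picks I) (λ (l , I′) → w l j * permanent w I′ J′))

permanent-transpose : ∀ w I J → length I ≡ length J → permanent w I J ≡ permanent (flip w) J I
permanent-transpose w []      []      _  = refl
permanent-transpose w (i ∷ I) (j ∷ J) eq = begin
  permanent w (i ∷ I) (j ∷ J)
    ≡⟨ ∑-picks-cong (j ∷ J) (λ {k} {J′} eq′ → cong (w i k *_)
         (permanent-transpose w I J′ (suc-injective (trans eq (sym eq′))))) ⟩
  ∑ (picks (j ∷ J)) (λ (k , J′) → w i k * permanent (flip w) J′ I)
    ≡⟨ cong (_+ Hits) (length<⇒permanent≡0 (flip w) (j ∷ J) I (≤-reflexive eq)) ⟨
  permanent (flip w) (j ∷ J) I + Hits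
    ≡⟨ permanent-column (flip w) (j ∷ J) i I ⟨
  permanent (flip w) (j ∷ J) (i ∷ I) ∎
  where
    Hits = ∑ (picks (j ∷ J)) (λ (k , J′) → w i k * permanent (flip w) J′ I)

permanent-↭ : ∀ w {I I′ J J′} → I ↭ I′ → J ↭ J′ → length I ≡ length J →
              permanent w I J ≡ permanent w I′ J′
permanent-↭ w {I} {I′} {J} {J′} I↭I′ J↭J′ eq = begin
  permanent w I J             ≡⟨ permanent-↭-rows w I↭I′ J ⟩
  permanent w I′ J            ≡⟨ permanent-transpose w I′ J (trans (sym (↭ₚ.↭-length I↭I′)) eq) ⟩
  permanent (flip w) J I′     ≡⟨ permanent-↭-rows (flip w) J↭J′ I′ ⟩
  permanent (flip w) J′ I′    ≡⟨ permanent-transpose (flip w) J′ I′ |J′|≡|I′| ⟩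
  permanent w I′ J′           ∎
  where
    |J′|≡|I′| = trans (sym (↭ₚ.↭-length J↭J′)) (trans (sym eq) (↭ₚ.↭-length I↭I′))

-- Each injection of I into J misses exactly length J ∸ length I columns.
∑-picks-permanent : ∀ w I J →
  ∑ (picks J) (λ (_ , J′) → permanent w I J′) ≡ (length J ∸ length I) * permanent w I J
∑-picks-permanent w []      J = trans (∑-picks-1 J) (sym (*-identityʳ (length J)))
∑-picks-permanent w (i ∷ I) J = begin
  ∑-pairs (λ _ k J″ → w i k * permanent w I J″) J
    ≡⟨ ∑-pairs-swap _ J ⟩
  ∑-pairs (λ k _ J″ → w i k * permanent w I J″) J
    ≡⟨ ∑-cong (λ (k , J′) → *-distribˡ-∑ (w i k) _ (picks J′)) (picks J) ⟨
  ∑ (picks J) (λ (k , J′) → w i k * ∑ (picks J′) (λ (_ , J″) → permanent w I J″))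
    ≡⟨ ∑-picks-cong J (λ {k} {J′} eq → trans
         (cong (w i k *_) (trans (∑-picks-permanent w I J′)
                                 (cong (λ n → (n ∸ suc (length I)) * permanent w I J′) eq)))
         (*-leftComm (w i k) (length J ∸ suc (length I)) (permanent w I J′))) ⟩
  ∑ (picks J) (λ (k , J′) → (length J ∸ suc (length I)) * (w i k * permanent w I J′))
    ≡⟨ *-distribˡ-∑ (length J ∸ suc (length I)) _ (picks J) ⟨
  (length J ∸ suc (length I)) * permanent w (i ∷ I) J ∎

∑-picks-permanent-+1 : ∀ w I J → length J ≡ suc (length I) →
                       ∑ (picks J) (λ (_ , J′) → permanent w I J′) ≡ permanent w I J
∑-picks-permanent-+1 w I J eq = begin
  ∑ (picks J) (λ (_ , J′) → permanent w I J′) ≡⟨ ∑-picks-permanent w I J ⟩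
  (length J ∸ length I) * permanent w I J     ≡⟨ cong (λ n → (n ∸ length I) * permanent w I J) eq ⟩
  (suc (length I) ∸ length I) * permanent w I J ≡⟨ cong (_* permanent w I J) (m+n∸n≡m 1 (length I)) ⟩
  1 * permanent w I J                         ≡⟨ *-identityˡ _ ⟩
  permanent w I J                             ∎

-- An extra row of weights at most 1 matches only the column the other rows leave free.
permanent-∷-≤ : ∀ w u I J → (∀ j → w u j ≤ 1) → length J ≡ suc (length I) →
                permanent w (u ∷ I) J ≤ permanent w I J
permanent-∷-≤ w u I J w≤1 eq = ≤-trans
  (∑-mono (λ (j , J′) → ≤-trans (*-monoˡ-≤ (permanent w I J′) (w≤1 j))
                                  (≤-reflexive (*-identityˡ _))) (picks J))
  (≤-reflexive (∑-picks-permanent-+1 w I J eq))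

Vanishes : (ℕ → ℕ → ℕ) → List ℕ → List ℕ → Set
Vanishes w A X = All (λ a → All (λ x → w a x ≡ 0) X) A

permanent-∷-++ : ∀ w a I X Y → All (λ x → w a x ≡ 0) X →
  permanent w (a ∷ I) (X ++ Y) ≡ ∑ (picks Y) (λ (y , Y′) → w a y * permanent w I (X ++ Y′))
permanent-∷-++ w a I X Y a⊥X = begin
  permanent w (a ∷ I) (X ++ Y)
    ≡⟨ ∑-picks-++ X Y _ ⟩
  ∑ (picks X) (λ (x , X′) → w a x * permanent w I (X′ ++ Y)) + IntoY
    ≡⟨ cong (_+ IntoY) (trans (∑-congᴬ (All.map (λ {(_ , X′)} (e , _) → cong (_* rest X′) e)
                                                (picks-All a⊥X)))
                              (∑-zero (picks X))) ⟩
  IntoY ∎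
  where
    rest = λ X′ → permanent w I (X′ ++ Y)
    IntoY = ∑ (picks Y) (λ (y , Y′) → w a y * permanent w I (X ++ Y′))

∑-picks-≤-permanent-∷-++ : ∀ w a I X Y →
  ∑ (picks X) (λ (x , X′) → w a x * permanent w I (X′ ++ Y)) ≤ permanent w (a ∷ I) (X ++ Y)
∑-picks-≤-permanent-∷-++ w a I X Y = ≤-trans (m≤m+n _ _) (≤-reflexive (sym (∑-picks-++ X Y _)))

permanent-++-block : ∀ w A B X Y → Vanishes w A X → length A ≡ length Y →
                     permanent w (A ++ B) (X ++ Y) ≡ permanent w A Y * permanent w B X
permanent-++-block w []      B X []      _ _ =
  trans (cong (permanent w B) (++-identityʳ X)) (sym (+-identityʳ _))
permanent-++-block w (a ∷ A) B X Y (a⊥X ∷ A⊥X) eq = begin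
  permanent w (a ∷ A ++ B) (X ++ Y)
    ≡⟨ permanent-∷-++ w a (A ++ B) X Y a⊥X ⟩
  ∑ (picks Y) (λ (y , Y′) → w a y * permanent w (A ++ B) (X ++ Y′))
    ≡⟨ ∑-picks-cong Y (λ {y} {Y′} eq′ → trans
         (cong (w a y *_) (permanent-++-block w A B X Y′ A⊥X (suc-injective (trans eq (sym eq′)))))
         (sym (*-assoc (w a y) _ _))) ⟩
  ∑ (picks Y) (λ (y , Y′) → w a y * permanent w A Y′ * permanent w B X)
    ≡⟨ *-distribʳ-∑ (permanent w B X) _ (picks Y) ⟨
  permanent w (a ∷ A) Y * permanent w B X ∎

permanent-++-block-+1 : ∀ w A B X Y → Vanishes w A X → length Y ≡ suc (length A) →
  permanent w (A ++ B) (X ++ Y)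
    ≡ ∑ (picks Y) (λ (u , Y′) → permanent w A Y′ * permanent w B (X ++ [ u ]))
permanent-++-block-+1 w []      B X (u ∷ []) _ _ = sym (trans (+-identityʳ _) (+-identityʳ _))
permanent-++-block-+1 w (a ∷ A) B X Y (a⊥X ∷ A⊥X) eq = begin
  permanent w (a ∷ A ++ B) (X ++ Y)
    ≡⟨ permanent-∷-++ w a (A ++ B) X Y a⊥X ⟩
  ∑ (picks Y) (λ (v , Y′) → w a v * permanent w (A ++ B) (X ++ Y′))
    ≡⟨ ∑-picks-cong Y (λ {v} {Y′} eq′ → trans
         (cong (w a v *_) (permanent-++-block-+1 w A B X Y′ A⊥X (suc-injective (trans eq′ eq))))
         (*-distribˡ-∑ (w a v) _ (picks Y′))) ⟩
  ∑-pairs (λ v u Y″ → w a v * (permanent w A Y″ * permanent w B (X ++ [ u ]))) Y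
    ≡⟨ ∑-pairs-swap _ Y ⟩
  ∑-pairs (λ u v Y″ → w a v * (permanent w A Y″ * permanent w B (X ++ [ u ]))) Y
    ≡⟨ ∑-pairs-cong (λ u v Y″ → sym (*-assoc (w a v) _ _)) Y ⟩
  ∑-pairs (λ u v Y″ → w a v * permanent w A Y″ * permanent w B (X ++ [ u ])) Y
    ≡⟨ ∑-cong (λ (u , Y′) → *-distribʳ-∑ (permanent w B (X ++ [ u ])) _ (picks Y′)) (picks Y) ⟨
  ∑ (picks Y) (λ (u , Y′) → permanent w (a ∷ A) Y′ * permanent w B (X ++ [ u ])) ∎

permanent-++-≥ : ∀ w A B X Y → length A ≡ length X →
                 permanent w A X * permanent w B Y ≤ permanent w (A ++ B) (X ++ Y)
permanent-++-≥ w []      B []      Y _  = ≤-reflexive (+-identityʳ _)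
permanent-++-≥ w (a ∷ A) B X       Y eq = ≤-trans
  (≤-reflexive (*-distribʳ-∑ (permanent w B Y) _ (picks X)))
  (≤-trans (∑-picks-mono X (λ {x} {X′} eq′ → ≤-trans
              (≤-reflexive (*-assoc (w a x) _ _))
              (*-monoʳ-≤ (w a x) (permanent-++-≥ w A B X′ Y (suc-injective (trans eq (sym eq′)))))))
           (∑-picks-≤-permanent-∷-++ w a (A ++ B) X Y))

permanent-derangements₃ : ∀ w a b c → w a a ≡ 0 → w b b ≡ 0 → w c c ≡ 0 →
  w a b ≡ 1 → w b a ≡ 1 → w a c ≡ 1 → w c a ≡ 1 → w b c ≡ 1 → w c b ≡ 1 →
  permanent w (a ∷ b ∷ c ∷ []) (a ∷ b ∷ c ∷ []) ≡ 2
permanent-derangements₃ w a b c aa bb cc ab ba ac ca bc cb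
  rewrite aa | bb | cc | ab | ba | ac | ca | bc | cb = refl

coprimality : ℕ → ℕ → ℕ
coprimality i j = if does (coprime? i j) then 1 else 0

coprimality-⇔ : ∀ {i j k l} → Coprime i j ⇔ Coprime k l → coprimality i j ≡ coprimality k l
coprimality-⇔ {i} {j} {k} {l} e = cong (if_then 1 else 0) (does-⇔ e (coprime? i j) (coprime? k l))

coprimality-sym : ∀ i j → coprimality i j ≡ coprimality j i
coprimality-sym i j = coprimality-⇔ {i} {j} (mk⇔ Coprime.sym Coprime.sym)

coprimality≤1 : ∀ i j → coprimality i j ≤ 1
coprimality≤1 i j with does (coprime? i j)
... | true  = ≤-refl
... | false = z≤n

coprime⇒coprimality≡1 : ∀ {i j} → Coprime i j → coprimality i j ≡ 1
coprime⇒coprimality≡1 {i} {j} c = cong (if_then 1 else 0) (dec-true (coprime? i j) c)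

¬coprime⇒coprimality≡0 : ∀ {i j} → ¬ Coprime i j → coprimality i j ≡ 0
¬coprime⇒coprimality≡0 {i} {j} ¬c = cong (if_then 1 else 0) (dec-false (coprime? i j) ¬c)

mutual
  coprimeInj≡permanent : ∀ I J → coprimeInj I J ≡ permanent coprimality I J
  coprimeInj≡permanent []      J = refl
  coprimeInj≡permanent (i ∷ I) J = sumChoices≡∑ i I (picks J)

  sumChoices≡∑ : ∀ i I ps →
    sumChoices i I ps ≡ ∑ ps (λ (j , J′) → coprimality i j * permanent coprimality I J′)
  sumChoices≡∑ i I []              = refl
  sumChoices≡∑ i I ((j , J′) ∷ ps) with gcd i j ≟ 1
  ... | yes gcd≡1 = cong₂ _+_ (begin
    coprimeInj I J′                               ≡⟨ coprimeInj≡permanent I J′ ⟩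
    permanent coprimality I J′                    ≡⟨ *-identityˡ _ ⟨
    1 * permanent coprimality I J′                ≡⟨ cong (_* permanent coprimality I J′) i⊥j ⟨
    coprimality i j * permanent coprimality I J′  ∎) (sumChoices≡∑ i I ps)
    where i⊥j = coprime⇒coprimality≡1 {i} {j} (gcd≡1⇒coprime gcd≡1)
  ... | no gcd≢1 = trans (sumChoices≡∑ i I ps)
    (cong (λ c → c * permanent coprimality I J′ + _) (sym i̸⊥j))
    where i̸⊥j = ¬coprime⇒coprimality≡0 {i} {j} (gcd≢1 ∘ coprime⇒gcd≡1)

coprimality-transpose : ∀ I J → length I ≡ length J →
                        permanent coprimality I J ≡ permanent coprimality J I
coprimality-transpose I J eq = trans (permanent-transpose coprimality I J eq)
  (permanent-cong J (All.universal (λ i → All.universal (λ j → coprimality-sym i j) J) I))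

double : ℕ → ℕ
double k = k + k

odd : ℕ → ℕ
odd k = suc (double k)

double≡2* : ∀ k → double k ≡ 2 * k
double≡2* k = cong (k +_) (sym (+-identityʳ k))

coprime-*ˡ-⇔ : ∀ {m n k} → Coprime m n → Coprime m (n * k) ⇔ Coprime m k
coprime-*ˡ-⇔ {_} {n} {k} m⊥n = mk⇔
  (λ m⊥nk {d} (d∣m , d∣k) → m⊥nk (d∣m , ∣-trans d∣k (n∣m*n n)))
  (λ m⊥k {d} (d∣m , d∣nk) → m⊥k (d∣m , coprime-factors m⊥n (∣-trans d∣m (m∣m*n k) , d∣nk)))

coprime-suc : ∀ a → Coprime a (suc a)
coprime-suc a = Coprime.sym (subst (λ b → Coprime b a) (+-comm a 1) (coprime-+ (1-coprimeTo a)))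

¬coprime-self : ∀ {a} → a ≢ 1 → ¬ Coprime a a
¬coprime-self a≢1 a⊥a = a≢1 (a⊥a (∣-refl , ∣-refl))

odd⊥2 : ∀ k → Coprime (odd k) 2
odd⊥2 zero    = 1-coprimeTo 2
odd⊥2 (suc k) = subst (λ m → Coprime (suc (suc m)) 2) (sym (+-suc k k)) (coprime-+ (odd⊥2 k))

odd⊥odd+2 : ∀ k → Coprime (odd k) (suc (suc (odd k)))
odd⊥odd+2 k =
  Coprime.sym (subst (λ m → Coprime m (odd k)) (+-comm (odd k) 2) (coprime-+ (Coprime.sym (odd⊥2 k))))

coprimality-odd-double : ∀ k j → coprimality (odd k) (double j) ≡ coprimality (odd k) j
coprimality-odd-double k j = begin
  coprimality (odd k) (double j) ≡⟨ cong (coprimality (odd k)) (double≡2* j) ⟩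
  coprimality (odd k) (2 * j)    ≡⟨ coprimality-⇔ (coprime-*ˡ-⇔ {k = j} (odd⊥2 k)) ⟩
  coprimality (odd k) j          ∎

coprimality-double-double : ∀ a b → coprimality (double a) (double b) ≡ 0
coprimality-double-double a b = ¬coprime⇒coprimality≡0 (λ c → case (c (2∣double a , 2∣double b)))
  where
    2∣double : ∀ k → 2 ∣ double k
    2∣double k = subst (2 ∣_) (sym (double≡2* k)) (m∣m*n k)
    case : 2 ≢ 1
    case ()

coprimality-double-odd : ∀ a k → coprimality (double a) (odd k) ≡ coprimality a (odd k)
coprimality-double-odd a k = begin
  coprimality (double a) (odd k) ≡⟨ coprimality-sym (double a) (odd k) ⟩
  coprimality (odd k) (double a) ≡⟨ coprimality-odd-double k a ⟩
  coprimality (odd k) a          ≡⟨ coprimality-sym (odd k) a ⟩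
  coprimality a (odd k)          ∎

coprimality-derangements₃ : ∀ {a b c} → a ≢ 1 → b ≢ 1 → c ≢ 1 →
  Coprime a b → Coprime a c → Coprime b c → permanent coprimality (a ∷ b ∷ c ∷ []) (a ∷ b ∷ c ∷ []) ≡ 2
coprimality-derangements₃ {a} {b} {c} a≢1 b≢1 c≢1 a⊥b a⊥c b⊥c =
  permanent-derangements₃ coprimality a b c (diagonal a≢1) (diagonal b≢1) (diagonal c≢1)
    (coprime⇒coprimality≡1 a⊥b) (coprime⇒coprimality≡1 (Coprime.sym a⊥b))
    (coprime⇒coprimality≡1 a⊥c) (coprime⇒coprimality≡1 (Coprime.sym a⊥c))
    (coprime⇒coprimality≡1 b⊥c) (coprime⇒coprimality≡1 (Coprime.sym b⊥c))
  where
    diagonal : ∀ {x} → x ≢ 1 → coprimality x x ≡ 0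
    diagonal {x} x≢1 = ¬coprime⇒coprimality≡0 {x} {x} (¬coprime-self x≢1)

evens : ℕ → List ℕ
evens n = map double (range n)

length-evens : ∀ n → length (evens n) ≡ n
length-evens n = trans (length-map double (range n)) (trans (length-map suc (upTo n)) (length-upTo n))

length-oddRange : ∀ n → length (oddRange n) ≡ n
length-oddRange n = trans (length-map odd (upTo n)) (length-upTo n)

-- Descending enumerations, on which splitting by parity is a plain induction.
range↓ evens↓ odds↓ : ℕ → List ℕ
range↓ n = map suc (downFrom n)
evens↓ n = map double (range↓ n)
odds↓  n = map odd (downFrom n)

upTo↭downFrom : ∀ n → upTo n ↭ downFrom n
upTo↭downFrom n = ↭-trans (↭-sym (↭ₚ.↭-reverse (upTo n))) (↭-reflexive (reverse-upTo n))

range↭range↓ : ∀ n → range n ↭ range↓ n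
range↭range↓ n = ↭ₚ.map⁺ suc (upTo↭downFrom n)

evens↓↭evens : ∀ n → evens↓ n ↭ evens n
evens↓↭evens n = ↭-sym (↭ₚ.map⁺ double (range↭range↓ n))

odds↓↭oddRange : ∀ n → odds↓ n ↭ oddRange n
odds↓↭oddRange n = ↭-sym (↭ₚ.map⁺ odd (upTo↭downFrom n))

range↓-double : ∀ n → range↓ (double n) ↭ evens↓ n ++ odds↓ n
range↓-double zero    = ↭.refl
range↓-double (suc n) rewrite +-suc n n =
  ↭.prep _ (↭-trans (↭.prep _ (range↓-double n)) (↭-sym (↭ₚ.shift _ (evens↓ n) (odds↓ n))))

range↓-odd : ∀ n → range↓ (odd n) ↭ evens↓ n ++ odds↓ (suc n)
range↓-odd n =
  ↭-trans (↭.prep (odd n) (range↓-double n)) (↭-sym (↭ₚ.shift (odd n) (evens↓ n) (odds↓ n)))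

2*n+1≡odd : ∀ n → 2 * n + 1 ≡ odd n
2*n+1≡odd n = trans (+-comm (2 * n) 1) (cong suc (sym (double≡2* n)))

range-2*-split : ∀ n → range (2 * n) ↭ evens n ++ oddRange n
range-2*-split n = ↭-trans (↭-reflexive (cong range (sym (double≡2* n))))
  (↭-trans (range↭range↓ (double n))
  (↭-trans (range↓-double n) (↭ₚ.++⁺ (evens↓↭evens n) (odds↓↭oddRange n))))

range-2*+1-split : ∀ n → range (2 * n + 1) ↭ evens n ++ oddRange (suc n)
range-2*+1-split n = ↭-trans (↭-reflexive (cong range (2*n+1≡odd n)))
  (↭-trans (range↭range↓ (odd n))
  (↭-trans (range↓-odd n) (↭ₚ.++⁺ (evens↓↭evens n) (odds↓↭oddRange (suc n)))))

range-2*+3-split : ∀ m →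
  range (2 * suc m + 1) ↭ (suc (suc (odd m)) ∷ suc (odd m) ∷ odd m ∷ []) ++ range (2 * m)
range-2*+3-split m =
  ↭-trans (↭-reflexive (cong range (trans (2*n+1≡odd (suc m)) (cong (suc ∘ suc) (+-suc m m)))))
  (↭-trans (range↭range↓ _)
  (↭.prep _ (↭.prep _ (↭.prep _ (↭-trans (↭-sym (range↭range↓ (double m)))
                                          (↭-reflexive (cong range (double≡2* m))))))))

evens-vanish : ∀ n → Vanishes coprimality (evens n) (evens n)
evens-vanish n = Allₚ.map⁺ (All.universal
  (λ a → Allₚ.map⁺ (All.universal (coprimality-double-double a) (range n))) (range n))

permanent-odds-evens : ∀ n → permanent coprimality (oddRange n) (evens n) ≡ C₀ n
permanent-odds-evens n = begin
  permanent coprimality (oddRange n) (map double (range n))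
    ≡⟨ permanent-map-columns coprimality double (oddRange n) (range n) ⟩
  permanent (λ i j → coprimality i (double j)) (oddRange n) (range n)
    ≡⟨ permanent-cong (oddRange n) (All.universal
         (λ j → Allₚ.map⁺ (All.universal (λ k → coprimality-odd-double k j) (upTo n))) (range n)) ⟩
  permanent coprimality (oddRange n) (range n)
    ≡⟨ coprimeInj≡permanent (oddRange n) (range n) ⟨
  C₀ n ∎

permanent-evens-odds : ∀ n → permanent coprimality (evens n) (oddRange (suc n)) ≡ C₁ n
permanent-evens-odds n = begin
  permanent coprimality (map double (range n)) (oddRange (suc n))
    ≡⟨ permanent-map-rows coprimality double (range n) (oddRange (suc n)) ⟩
  permanent (coprimality ∘ double) (range n) (oddRange (suc n))
    ≡⟨ permanent-cong (range n) (Allₚ.map⁺ (All.universal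
         (λ k → All.universal (λ a → coprimality-double-odd a k) (range n)) (upTo (suc n)))) ⟩
  permanent coprimality (range n) (oddRange (suc n))
    ≡⟨ coprimeInj≡permanent (range n) (oddRange (suc n)) ⟨
  C₁ n ∎

C-even : ∀ n → C (2 * n) ≡ C₀ n * C₀ n
C-even n = begin
  C (2 * n)                       ≡⟨ coprimeInj≡permanent R R ⟩
  P R R                           ≡⟨ permanent-↭ coprimality (range-2*-split n) (range-2*-split n) refl ⟩
  P (E ++ O) (E ++ O)             ≡⟨ permanent-++-block coprimality E O E O (evens-vanish n) |E|≡|O| ⟩
  P E O * P O E                   ≡⟨ cong (_* P O E) (coprimality-transpose E O |E|≡|O|) ⟩
  P O E * P O E                   ≡⟨ cong₂ _*_ (permanent-odds-evens n) (permanent-odds-evens n) ⟩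
  C₀ n * C₀ n                     ∎
  where
    P = permanent coprimality
    R = range (2 * n)
    E = evens n
    O = oddRange n
    |E|≡|O| = trans (length-evens n) (sym (length-oddRange n))

C-odd-≤ : ∀ n → C (2 * n + 1) ≤ C₁ n * C₁ n
C-odd-≤ n = ≤-trans (≤-reflexive split)
  (≤-trans (∑-mono (λ (u , O′) → *-monoʳ-≤ (P E O′) (fill-≤ u)) (picks O)) (≤-reflexive collect))
  where
    P = permanent coprimality
    R = range (2 * n + 1)
    E = evens n
    O = oddRange (suc n)
    |O|≡1+|E| = trans (length-oddRange (suc n)) (cong suc (sym (length-evens n)))

    split : C (2 * n + 1) ≡ ∑ (picks O) (λ (u , O′) → P E O′ * P O (E ++ [ u ]))
    split = begin
      C (2 * n + 1)        ≡⟨ coprimeInj≡permanent R R ⟩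
      P R R                ≡⟨ permanent-↭ coprimality (range-2*+1-split n) (range-2*+1-split n) refl ⟩
      P (E ++ O) (E ++ O)  ≡⟨ permanent-++-block-+1 coprimality E O E O (evens-vanish n) |O|≡1+|E| ⟩
      ∑ (picks O) (λ (u , O′) → P E O′ * P O (E ++ [ u ])) ∎

    fill-≤ : ∀ u → P O (E ++ [ u ]) ≤ P E O
    fill-≤ u = ≤-trans (≤-reflexive (begin
      P O (E ++ [ u ])
        ≡⟨ coprimality-transpose O (E ++ [ u ]) (trans |O|≡1+|E| (↭ₚ.↭-length u∷E↭E∷ʳu)) ⟩
      P (E ++ [ u ]) O
        ≡⟨ permanent-↭-rows coprimality (↭-sym u∷E↭E∷ʳu) O ⟩
      P (u ∷ E) O ∎))
      (permanent-∷-≤ coprimality u E O (coprimality≤1 u) |O|≡1+|E|)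
      where u∷E↭E∷ʳu = ↭ₚ.∷↭∷ʳ u E

    collect : ∑ (picks O) (λ (_ , O′) → P E O′ * P E O) ≡ C₁ n * C₁ n
    collect = begin
      ∑ (picks O) (λ (_ , O′) → P E O′ * P E O)
        ≡⟨ *-distribʳ-∑ (P E O) (λ (_ , O′) → P E O′) (picks O) ⟨
      ∑ (picks O) (λ (_ , O′) → P E O′) * P E O
        ≡⟨ cong (_* P E O) (∑-picks-permanent-+1 coprimality E O |O|≡1+|E|) ⟩
      P E O * P E O
        ≡⟨ cong₂ _*_ (permanent-evens-odds n) (permanent-evens-odds n) ⟩
      C₁ n * C₁ n ∎

C-odd-≥ : ∀ n → 2 ≤ n → 2 * C (2 * (n ∸ 1)) ≤ C (2 * n + 1)
C-odd-≥ (suc zero)    (s≤s ())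
C-odd-≥ (suc (suc k)) _ = ≤-trans
  (≤-reflexive (cong₂ _*_ (sym derangements) (coprimeInj≡permanent R′ R′)))
  (≤-trans (permanent-++-≥ coprimality T R′ T R′ refl)
           (≤-reflexive (sym (trans (coprimeInj≡permanent R R)
                                    (permanent-↭ coprimality R↭T++R′ R↭T++R′ refl)))))
  where
    m = suc k
    a = odd m
    T = suc (suc a) ∷ suc a ∷ a ∷ []
    R = range (2 * suc m + 1)
    R′ = range (2 * m)
    R↭T++R′ = range-2*+3-split m
    derangements : permanent coprimality T T ≡ 2
    derangements = coprimality-derangements₃ (λ ()) (λ ()) (λ ())
      (Coprime.sym (coprime-suc (suc a))) (Coprime.sym (odd⊥odd+2 m)) (Coprime.sym (coprime-suc a))

lemma2p1 : ((n : ℕ) → 1 ≤ n → C (2 * n) ≡ C₀ n * C₀ n)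
    × ((n : ℕ) → 2 ≤ n → 2 * (C₀ (n ∸ 1) * C₀ (n ∸ 1)) ≤ C (2 * n + 1) × C (2 * n + 1) ≤ C₁ n * C₁ n)
lemma2p1 = (λ n _ → C-even n) , λ n 2≤n →
  ≤-trans (≤-reflexive (cong (2 *_) (sym (C-even (n ∸ 1))))) (C-odd-≥ n 2≤n) , C-odd-≤ n
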